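{- Let $n,\lambda,\mu,\nu$ be nonnegative integers with $\lambda>1+\mu+\nu$. Then \[\sum_{k=0}^n \frac{\binom{n}{k}\binom{\lambda n+k}{k}\binom{\mu n+n}{k}}{\binom{\nu n+k}{k}\binom{(\lambda-\mu-\nu-2)n+k}{k}}\Big\{H_{\mu n+n-k}-H_{(\lambda-\mu-\nu-2)n+k}\Big\} = \frac{\binom{(\lambda-\nu)n}{n}\binom{(\mu+\nu+2)n}{n}}{\binom{\nu n+n}{n}\binom{(\lambda-\mu-\nu-1)n}{n}}\Big\{H_{(\mu+\nu+1)n}-H_{(\mu+\nu+2)n}+H_{\mu n+n}-H_{(\lambda-\mu-\nu-1)n}\Big\}.\]
   Context: $H_0=0$ and $H_m=\sum_{j=1}^m \frac{1}{j}$ for positive integers $m$ (classical harmonic numbers). -}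

module Defs where

open import Data.Nat as ℕ using (ℕ; zero; suc)
open import Data.Nat.Combinatorics using (_C_)
open import Data.Integer using (+_)
open import Data.Rational using (ℚ; 0ℚ; _/_; _+_; _*_)

-- natural-number quotient a / d as a rational number.
-- Convention: the value for d = 0 is 0 (never used in the statement:
-- all denominators there are binomials C(m+k,k) ≥ 1).
_÷ℕ_ : ℕ → ℕ → ℚ
a ÷ℕ zero = 0ℚ
a ÷ℕ suc d = (+ a) / suc d

H : ℕ → ℚ
H zero = 0ℚ
H (suc m) = H m + (1 ÷ℕ suc m)

sumTo : ℕ → (ℕ → ℚ) → ℚ
sumTo zero f = f 0
sumTo (suc n) f = sumTo n f + f (suc n)

-- Write t(k) = C(N,k) C(L+k,k) C(M,k) / (C(V+k,k) C(A+k,k)) with L = V + A + M + N; the theorem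
-- is the case N = n, M = (μ+1)n, V = νn, A = (λ-μ-ν-2)n, L = λn.  Both the Pfaff–Saalschütz sum
-- Σₖ t(k) and its harmonic companion Σₖ t(k) (H(M-k) - H(A+k)) are computed by induction on N.
-- A WZ pair relates the summands for (N+1, L+1) and (N, L), so summing it gives a first-order
-- recurrence in N.  For the harmonic sum, summation by parts against the weights leaves an
-- inhomogeneous term which, after trading N+1 for A+1 in the summand, is again a Saalschütz sum.
-- The closed forms satisfy the same recurrences.

module Submission where

open import Data.Integer as ℤ using (+_)
import Data.Integer.Properties as ℤ
open import Data.List using (_∷_; [])
open import Data.Maybe using (Maybe; just; nothing)
open import Data.Product using (∃-syntax; _,_)
open import Data.Nat as ℕ using (ℕ; zero; suc; _≤_; _<_; z≤n; s≤s; NonZero)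
import Data.Nat.Properties as ℕ
import Data.Nat.Tactic.RingSolver as ℕ
open import Data.Nat.Combinatorics using (_C_; nCk+nC[k+1]≡[n+1]C[k+1]; k>n⇒nCk≡0; nC1≡n)
open import Data.Rational using (ℚ; 0ℚ; 1ℚ; _+_; _*_; _-_; -_; fromℚᵘ)
open import Data.Rational.Properties
  using (+-*-commutativeRing; +-assoc; +-identityʳ; *-identityˡ; *-zeroˡ; *-comm; *-distribˡ-+; *-distribʳ-+; neg-distribˡ-*; _≟_; toℚᵘ-injective; toℚᵘ-fromℚᵘ; toℚᵘ-homo-+; toℚᵘ-homo-*; fromℚᵘ-cong)
import Data.Rational.Unnormalised as ℚᵘ
import Data.Rational.Unnormalised.Properties as ℚᵘ
open import Relation.Binary.PropositionalEquality
open import Relation.Nullary using (yes; no)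
open import Tactic.RingSolver using (solve; solve-∀)
open import Tactic.RingSolver.Core.AlmostCommutativeRing using (AlmostCommutativeRing; fromCommutativeRing)

open import Defs

open ≡-Reasoning

-- The reflective solver only treats bound variables as atoms, so every identity involving casts,
-- binomials or sums is first stated for arbitrary rationals in a local lemma.
ℚ-ring : AlmostCommutativeRing _ _
ℚ-ring = fromCommutativeRing +-*-commutativeRing isZero
  where
  isZero : ∀ x → Maybe (0ℚ ≡ x)
  isZero x with 0ℚ ≟ x
  ... | yes p = just p
  ... | no _  = nothing

-- Nesting this proves p ≡ q from hypotheses lᵢ ≡ rᵢ once p - q - Σ cᵢ (lᵢ - rᵢ) is a ring identity.
linear-combination : ∀ {p q l r : ℚ} c → l ≡ r → p ≡ q + c * (l - r) → p ≡ q
linear-combination {q = q} {r = r} c refl p≡q+c*0 = trans p≡q+c*0 (q+c*0≡q q c r)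
  where
  q+c*0≡q : ∀ q c r → q + c * (r - r) ≡ q
  q+c*0≡q = solve-∀ ℚ-ring

product-inverse : ∀ i x j y → i * x ≡ 1ℚ → j * y ≡ 1ℚ → i * j * (x * y) ≡ 1ℚ
product-inverse i x j y ix≡1 jy≡1 = linear-combination (i * x) jy≡1 (linear-combination 1ℚ ix≡1
  (solve (i ∷ x ∷ j ∷ y ∷ []) ℚ-ring))

*-cancelʳ-invertible : ∀ {x y b} i → i * b ≡ 1ℚ → x * b ≡ y * b → x ≡ y
*-cancelʳ-invertible {x} {y} {b} i ib≡1 xb≡yb =
  linear-combination (y - x) ib≡1 (linear-combination i xb≡yb (solve (x ∷ y ∷ b ∷ i ∷ []) ℚ-ring))

*-ratio : ∀ σ ρ x x′ σ′ ρ′ y y′ → σ * x′ ≡ ρ * x → σ′ * y′ ≡ ρ′ * y →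
          σ * σ′ * (x′ * y′) ≡ ρ * ρ′ * (x * y)
*-ratio σ ρ x x′ σ′ ρ′ y y′ e e′ = begin
  σ * σ′ * (x′ * y′)  ≡⟨ solve (σ ∷ σ′ ∷ x′ ∷ y′ ∷ []) ℚ-ring ⟩
  σ * x′ * (σ′ * y′)  ≡⟨ cong₂ _*_ e e′ ⟩
  ρ * x * (ρ′ * y)    ≡⟨ solve (ρ ∷ ρ′ ∷ x ∷ y ∷ []) ℚ-ring ⟩
  ρ * ρ′ * (x * y)    ∎

quotient-ratio : ∀ t t′ u u′ d d′ σ ρ σ′ ρ′ → t * d ≡ u → t′ * d′ ≡ u′ →
                 σ * u′ ≡ ρ * u → σ′ * d′ ≡ ρ′ * d → t′ * (σ * ρ′) * d ≡ t * (ρ * σ′) * d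
quotient-ratio t t′ u u′ d d′ σ ρ σ′ ρ′ td≡u t′d′≡u′ num den = begin
  t′ * (σ * ρ′) * d    ≡⟨ solve (t′ ∷ σ ∷ ρ′ ∷ d ∷ []) ℚ-ring ⟩
  t′ * σ * (ρ′ * d)    ≡⟨ cong (t′ * σ *_) den ⟨
  t′ * σ * (σ′ * d′)   ≡⟨ solve (t′ ∷ σ ∷ σ′ ∷ d′ ∷ []) ℚ-ring ⟩
  σ′ * (σ * (t′ * d′)) ≡⟨ cong (λ z → σ′ * (σ * z)) t′d′≡u′ ⟩
  σ′ * (σ * u′)        ≡⟨ cong (σ′ *_) num ⟩
  σ′ * (ρ * u)         ≡⟨ cong (λ z → σ′ * (ρ * z)) td≡u ⟨
  σ′ * (ρ * (t * d))   ≡⟨ solve (t ∷ d ∷ ρ ∷ σ′ ∷ []) ℚ-ring ⟩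
  t * (ρ * σ′) * d     ∎

recurrence-transfer : ∀ S S′ D D′ U U′ σ α β i → i * σ ≡ 1ℚ →
  S * D ≡ U → σ * D′ ≡ α * D → σ * U′ ≡ β * U → S′ * α ≡ S * β → S′ * D′ ≡ U′
recurrence-transfer S S′ D D′ U U′ σ α β i iσ≡1 SD≡U D-step U-step S-step = *-cancelʳ-invertible i iσ≡1 (begin
  S′ * D′ * σ    ≡⟨ solve (S′ ∷ D′ ∷ σ ∷ []) ℚ-ring ⟩
  S′ * (σ * D′)  ≡⟨ cong (S′ *_) D-step ⟩
  S′ * (α * D)   ≡⟨ solve (S′ ∷ α ∷ D ∷ []) ℚ-ring ⟩
  S′ * α * D     ≡⟨ cong (_* D) S-step ⟩
  S * β * D      ≡⟨ solve (S ∷ β ∷ D ∷ []) ℚ-ring ⟩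
  β * (S * D)    ≡⟨ cong (β *_) SD≡U ⟩
  β * U          ≡⟨ U-step ⟨
  σ * U′         ≡⟨ *-comm σ U′ ⟩
  U′ * σ         ∎)

fromℚᵘ-homo-+ : ∀ p q → fromℚᵘ (p ℚᵘ.+ q) ≡ fromℚᵘ p + fromℚᵘ q
fromℚᵘ-homo-+ p q = toℚᵘ-injective (ℚᵘ.≃-trans (toℚᵘ-fromℚᵘ _) (ℚᵘ.≃-sym
  (ℚᵘ.≃-trans (toℚᵘ-homo-+ (fromℚᵘ p) (fromℚᵘ q)) (ℚᵘ.+-cong (toℚᵘ-fromℚᵘ p) (toℚᵘ-fromℚᵘ q)))))

fromℚᵘ-homo-* : ∀ p q → fromℚᵘ (p ℚᵘ.* q) ≡ fromℚᵘ p * fromℚᵘ q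
fromℚᵘ-homo-* p q = toℚᵘ-injective (ℚᵘ.≃-trans (toℚᵘ-fromℚᵘ _) (ℚᵘ.≃-sym
  (ℚᵘ.≃-trans (toℚᵘ-homo-* (fromℚᵘ p) (fromℚᵘ q)) (ℚᵘ.*-cong (toℚᵘ-fromℚᵘ p) (toℚᵘ-fromℚᵘ q)))))

-- Opaque, so that conversion checking never unfolds casts into gcd normalisation.
opaque
  ⟦_⟧ : ℕ → ℚ
  ⟦ n ⟧ = fromℚᵘ (ℚᵘ.mkℚᵘ (+ n) 0)

  ⟦0⟧ : ⟦ 0 ⟧ ≡ 0ℚ
  ⟦0⟧ = refl

  ⟦1⟧ : ⟦ 1 ⟧ ≡ 1ℚ
  ⟦1⟧ = refl

  ⟦+⟧ : ∀ m n → ⟦ m ℕ.+ n ⟧ ≡ ⟦ m ⟧ + ⟦ n ⟧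
  ⟦+⟧ m n = trans (fromℚᵘ-cong {ℚᵘ.mkℚᵘ (+ (m ℕ.+ n)) 0} {ℚᵘ.mkℚᵘ (+ m) 0 ℚᵘ.+ ℚᵘ.mkℚᵘ (+ n) 0} (ℚᵘ.*≡* eq))
                  (fromℚᵘ-homo-+ (ℚᵘ.mkℚᵘ (+ m) 0) (ℚᵘ.mkℚᵘ (+ n) 0))
    where
    eq : + (m ℕ.+ n) ℤ.* + 1 ≡ (+ m ℤ.* + 1 ℤ.+ + n ℤ.* + 1) ℤ.* + 1
    eq = cong (ℤ._* + 1) (trans (ℤ.pos-+ m n)
           (sym (cong₂ ℤ._+_ (ℤ.*-identityʳ (+ m)) (ℤ.*-identityʳ (+ n)))))

  ⟦*⟧ : ∀ m n → ⟦ m ℕ.* n ⟧ ≡ ⟦ m ⟧ * ⟦ n ⟧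
  ⟦*⟧ m n = trans (fromℚᵘ-cong {ℚᵘ.mkℚᵘ (+ (m ℕ.* n)) 0} {ℚᵘ.mkℚᵘ (+ m) 0 ℚᵘ.* ℚᵘ.mkℚᵘ (+ n) 0} (ℚᵘ.*≡* eq))
                  (fromℚᵘ-homo-* (ℚᵘ.mkℚᵘ (+ m) 0) (ℚᵘ.mkℚᵘ (+ n) 0))
    where
    eq : + (m ℕ.* n) ℤ.* + 1 ≡ (+ m ℤ.* + n) ℤ.* + 1
    eq = cong (ℤ._* + 1) (ℤ.pos-* m n)

  ÷ℕ-*-cancel : ∀ a b .{{_ : NonZero b}} → (a ÷ℕ b) * ⟦ b ⟧ ≡ ⟦ a ⟧
  ÷ℕ-*-cancel a (suc d) = trans (sym (fromℚᵘ-homo-* (ℚᵘ.mkℚᵘ (+ a) d) (ℚᵘ.mkℚᵘ (+ suc d) 0)))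
    (fromℚᵘ-cong {ℚᵘ.mkℚᵘ (+ a) d ℚᵘ.* ℚᵘ.mkℚᵘ (+ suc d) 0} {ℚᵘ.mkℚᵘ (+ a) 0} (ℚᵘ.*≡* eq))
    where
    eq : (+ a ℤ.* + suc d) ℤ.* + 1 ≡ + a ℤ.* + suc (d ℕ.* 1)
    eq rewrite ℕ.*-identityʳ d = ℤ.*-identityʳ (+ a ℤ.* + suc d)

⟦suc⟧ : ∀ n → ⟦ suc n ⟧ ≡ 1ℚ + ⟦ n ⟧
⟦suc⟧ n = trans (⟦+⟧ 1 n) (cong (_+ ⟦ n ⟧) ⟦1⟧)

⟦suc+⟧ : ∀ x k → ⟦ suc (x ℕ.+ k) ⟧ ≡ 1ℚ + ⟦ x ⟧ + ⟦ k ⟧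
⟦suc+⟧ x k = trans (⟦suc⟧ (x ℕ.+ k)) (trans (cong (λ z → 1ℚ + z) (⟦+⟧ x k)) (sym (+-assoc 1ℚ ⟦ x ⟧ ⟦ k ⟧)))

⟦+⟧₄ : ∀ a b c d → ⟦ a ℕ.+ b ℕ.+ c ℕ.+ d ⟧ ≡ ⟦ a ⟧ + ⟦ b ⟧ + ⟦ c ⟧ + ⟦ d ⟧
⟦+⟧₄ a b c d = trans (⟦+⟧ (a ℕ.+ b ℕ.+ c) d) (cong (_+ ⟦ d ⟧) (trans (⟦+⟧ (a ℕ.+ b) c) (cong (_+ ⟦ c ⟧) (⟦+⟧ a b))))

⟦∸⟧ : ∀ {m n} → n ≤ m → ⟦ m ℕ.∸ n ⟧ ≡ ⟦ m ⟧ - ⟦ n ⟧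
⟦∸⟧ {m} {n} n≤m = begin
  ⟦ m ℕ.∸ n ⟧                  ≡⟨ x≡x+y-y ⟦ m ℕ.∸ n ⟧ ⟦ n ⟧ ⟩
  ⟦ m ℕ.∸ n ⟧ + ⟦ n ⟧ - ⟦ n ⟧  ≡⟨ cong (_- ⟦ n ⟧) (sym (⟦+⟧ (m ℕ.∸ n) n)) ⟩
  ⟦ m ℕ.∸ n ℕ.+ n ⟧ - ⟦ n ⟧    ≡⟨ cong (λ k → ⟦ k ⟧ - ⟦ n ⟧) (ℕ.m∸n+n≡m n≤m) ⟩
  ⟦ m ⟧ - ⟦ n ⟧                ∎
  where
  x≡x+y-y : ∀ x y → x ≡ x + y - y
  x≡x+y-y = solve-∀ ℚ-ring

1÷ℕ-inverse : ∀ b .{{_ : NonZero b}} → (1 ÷ℕ b) * ⟦ b ⟧ ≡ 1ℚ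
1÷ℕ-inverse b = trans (÷ℕ-*-cancel 1 b) ⟦1⟧

1÷ℕ-inverse-suc : ∀ k → (1 ÷ℕ suc k) * (1ℚ + ⟦ k ⟧) ≡ 1ℚ
1÷ℕ-inverse-suc k = trans (cong ((1 ÷ℕ suc k) *_) (sym (⟦suc⟧ k))) (1÷ℕ-inverse (suc k))

1÷ℕ-inverse-suc+ : ∀ x k → (1 ÷ℕ suc (x ℕ.+ k)) * (1ℚ + ⟦ x ⟧ + ⟦ k ⟧) ≡ 1ℚ
1÷ℕ-inverse-suc+ x k = trans (cong ((1 ÷ℕ suc (x ℕ.+ k)) *_) (sym (⟦suc+⟧ x k))) (1÷ℕ-inverse (suc (x ℕ.+ k)))

*-cancelʳ-⟦⟧ : ∀ b .{{_ : NonZero b}} {x y} → x * ⟦ b ⟧ ≡ y * ⟦ b ⟧ → x ≡ y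
*-cancelʳ-⟦⟧ b = *-cancelʳ-invertible (1 ÷ℕ b) (1÷ℕ-inverse b)

*-cancelʳ-⟦⟧² : ∀ a b .{{_ : NonZero a}} .{{_ : NonZero b}} {x y} →
                x * (⟦ a ⟧ * ⟦ b ⟧) ≡ y * (⟦ a ⟧ * ⟦ b ⟧) → x ≡ y
*-cancelʳ-⟦⟧² a b {x} {y} eq = *-cancelʳ-⟦⟧ (a ℕ.* b) {{ℕ.m*n≢0 a b}}
  (trans (cong (x *_) (⟦*⟧ a b)) (trans eq (cong (y *_) (sym (⟦*⟧ a b)))))

-- Binomial coefficients

C-pascal : ∀ n k → suc n C suc k ≡ n C k ℕ.+ n C suc k
C-pascal n k = sym (nCk+nC[k+1]≡[n+1]C[k+1] n k)

C-absorption : ∀ n k → suc k ℕ.* (suc n C suc k) ≡ suc n ℕ.* (n C k)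
C-absorption zero    zero    = refl
C-absorption zero    (suc k) = ℕ.*-zeroʳ (suc (suc k))
C-absorption (suc n) zero    = trans (ℕ.*-identityˡ _) (trans (nC1≡n (suc (suc n))) (sym (ℕ.*-identityʳ (suc (suc n)))))
C-absorption (suc n) (suc k) = begin
  suc (suc k) ℕ.* (suc (suc n) C suc (suc k))
    ≡⟨ cong (suc (suc k) ℕ.*_) (C-pascal (suc n) (suc k)) ⟩
  suc (suc k) ℕ.* (suc n C suc k ℕ.+ suc n C suc (suc k))
    ≡⟨ expand k (suc n C suc k) (suc n C suc (suc k)) ⟩
  suc n C suc k ℕ.+ suc k ℕ.* (suc n C suc k) ℕ.+ suc (suc k) ℕ.* (suc n C suc (suc k))
    ≡⟨ cong₂ (λ x y → suc n C suc k ℕ.+ x ℕ.+ y) (C-absorption n k) (C-absorption n (suc k)) ⟩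
  suc n C suc k ℕ.+ suc n ℕ.* (n C k) ℕ.+ suc n ℕ.* (n C suc k)
    ≡⟨ ℕ.+-assoc (suc n C suc k) _ _ ⟩
  suc n C suc k ℕ.+ (suc n ℕ.* (n C k) ℕ.+ suc n ℕ.* (n C suc k))
    ≡⟨ cong (suc n C suc k ℕ.+_) (sym (ℕ.*-distribˡ-+ (suc n) (n C k) (n C suc k))) ⟩
  suc n C suc k ℕ.+ suc n ℕ.* (n C k ℕ.+ n C suc k)
    ≡⟨ cong (λ x → suc n C suc k ℕ.+ suc n ℕ.* x) (sym (C-pascal n k)) ⟩
  suc (suc n) ℕ.* (suc n C suc k)
    ∎
  where
  expand : ∀ k x y → suc (suc k) ℕ.* (x ℕ.+ y) ≡ x ℕ.+ suc k ℕ.* x ℕ.+ suc (suc k) ℕ.* y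
  expand = ℕ.solve-∀

C-pos : ∀ {n k} → k ≤ n → 0 < n C k
C-pos {n}     {zero}  _         = s≤s z≤n
C-pos {suc n} {suc k} (s≤s k≤n) = ℕ.<-≤-trans (C-pos k≤n) (subst (n C k ≤_) (sym (C-pascal n k)) (ℕ.m≤m+n _ _))

C-nonZero : ∀ x k → NonZero ((x ℕ.+ k) C k)
C-nonZero x k = ℕ.>-nonZero (C-pos (ℕ.m≤n+m k x))

⟦C-pascal⟧ : ∀ n k → ⟦ suc n C suc k ⟧ ≡ ⟦ n C k ⟧ + ⟦ n C suc k ⟧
⟦C-pascal⟧ n k = trans (cong ⟦_⟧ (C-pascal n k)) (⟦+⟧ (n C k) (n C suc k))

⟦C-absorption⟧ : ∀ n k → (1ℚ + ⟦ k ⟧) * ⟦ suc n C suc k ⟧ ≡ (1ℚ + ⟦ n ⟧) * ⟦ n C k ⟧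
⟦C-absorption⟧ n k = begin
  (1ℚ + ⟦ k ⟧) * ⟦ suc n C suc k ⟧   ≡⟨ cong (_* ⟦ suc n C suc k ⟧) (⟦suc⟧ k) ⟨
  ⟦ suc k ⟧ * ⟦ suc n C suc k ⟧      ≡⟨ ⟦*⟧ (suc k) (suc n C suc k) ⟨
  ⟦ suc k ℕ.* (suc n C suc k) ⟧      ≡⟨ cong ⟦_⟧ (C-absorption n k) ⟩
  ⟦ suc n ℕ.* (n C k) ⟧              ≡⟨ ⟦*⟧ (suc n) (n C k) ⟩
  ⟦ suc n ⟧ * ⟦ n C k ⟧              ≡⟨ cong (_* ⟦ n C k ⟧) (⟦suc⟧ n) ⟩
  (1ℚ + ⟦ n ⟧) * ⟦ n C k ⟧           ∎

C[n,k]-suc-k : ∀ n k → (1ℚ + ⟦ k ⟧) * ⟦ n C suc k ⟧ ≡ (⟦ n ⟧ - ⟦ k ⟧) * ⟦ n C k ⟧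
C[n,k]-suc-k n k = step ⟦ n ⟧ ⟦ k ⟧ ⟦ n C k ⟧ ⟦ n C suc k ⟧ ⟦ suc n C suc k ⟧ (⟦C-absorption⟧ n k) (⟦C-pascal⟧ n k)
  where
  step : ∀ n k x y p → (1ℚ + k) * p ≡ (1ℚ + n) * x → p ≡ x + y → (1ℚ + k) * y ≡ (n - k) * x
  step n k x y p absorb pascal = linear-combination 1ℚ absorb
    (linear-combination (- (1ℚ + k)) pascal (solve (n ∷ k ∷ x ∷ y ∷ p ∷ []) ℚ-ring))

C[n,k]-suc-n : ∀ n k → (1ℚ + ⟦ n ⟧ - ⟦ k ⟧) * ⟦ suc n C k ⟧ ≡ (1ℚ + ⟦ n ⟧) * ⟦ n C k ⟧
C[n,k]-suc-n n zero = trans (cong (λ z → (1ℚ + ⟦ n ⟧ - z) * ⟦ 1 ⟧) ⟦0⟧) (x-0≡x (1ℚ + ⟦ n ⟧) ⟦ 1 ⟧)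
  where
  x-0≡x : ∀ x c → (x - 0ℚ) * c ≡ x * c
  x-0≡x = solve-∀ ℚ-ring
C[n,k]-suc-n n (suc k) = step ⟦ n ⟧ ⟦ k ⟧ ⟦ suc k ⟧ ⟦ n C k ⟧ ⟦ n C suc k ⟧ ⟦ suc n C suc k ⟧
  (⟦suc⟧ k) (C[n,k]-suc-k n k) (⟦C-pascal⟧ n k)
  where
  step : ∀ n k k+1 x y p → k+1 ≡ 1ℚ + k → (1ℚ + k) * y ≡ (n - k) * x → p ≡ x + y →
         (1ℚ + n - k+1) * p ≡ (1ℚ + n) * y
  step n k _ x y p refl down pascal = linear-combination (- 1ℚ) down
    (linear-combination (n - k) pascal (solve (n ∷ k ∷ x ∷ y ∷ p ∷ []) ℚ-ring))

C[x+k,k]-suc-k : ∀ x k → (1ℚ + ⟦ k ⟧) * ⟦ (x ℕ.+ suc k) C suc k ⟧ ≡ (1ℚ + ⟦ x ⟧ + ⟦ k ⟧) * ⟦ (x ℕ.+ k) C k ⟧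
C[x+k,k]-suc-k x k rewrite ℕ.+-suc x k = begin
  (1ℚ + ⟦ k ⟧) * ⟦ suc (x ℕ.+ k) C suc k ⟧   ≡⟨ ⟦C-absorption⟧ (x ℕ.+ k) k ⟩
  (1ℚ + ⟦ x ℕ.+ k ⟧) * ⟦ (x ℕ.+ k) C k ⟧     ≡⟨ cong (λ z → (1ℚ + z) * ⟦ (x ℕ.+ k) C k ⟧) (⟦+⟧ x k) ⟩
  (1ℚ + (⟦ x ⟧ + ⟦ k ⟧)) * ⟦ (x ℕ.+ k) C k ⟧  ≡⟨ cong (_* ⟦ (x ℕ.+ k) C k ⟧) (+-assoc 1ℚ ⟦ x ⟧ ⟦ k ⟧) ⟨
  (1ℚ + ⟦ x ⟧ + ⟦ k ⟧) * ⟦ (x ℕ.+ k) C k ⟧    ∎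

C[x+k,k]-suc-x : ∀ x k → (1ℚ + ⟦ x ⟧) * ⟦ (suc x ℕ.+ k) C k ⟧ ≡ (1ℚ + ⟦ x ⟧ + ⟦ k ⟧) * ⟦ (x ℕ.+ k) C k ⟧
C[x+k,k]-suc-x x k = step ⟦ x ⟧ ⟦ k ⟧ ⟦ x ℕ.+ k ⟧ ⟦ (suc x ℕ.+ k) C k ⟧ ⟦ (x ℕ.+ k) C k ⟧ (⟦+⟧ x k) (C[n,k]-suc-n (x ℕ.+ k) k)
  where
  step : ∀ x k x+k c′ c → x+k ≡ x + k → (1ℚ + x+k - k) * c′ ≡ (1ℚ + x+k) * c →
         (1ℚ + x) * c′ ≡ (1ℚ + x + k) * c
  step x k _ c′ c refl suc-n = linear-combination 1ℚ suc-n (solve (x ∷ k ∷ c′ ∷ c ∷ []) ℚ-ring)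

sumTo-cong : ∀ n {f g : ℕ → ℚ} → (∀ k → k ≤ n → f k ≡ g k) → sumTo n f ≡ sumTo n g
sumTo-cong zero    f≗g = f≗g 0 z≤n
sumTo-cong (suc n) f≗g = cong₂ _+_ (sumTo-cong n (λ k k≤n → f≗g k (ℕ.m≤n⇒m≤1+n k≤n))) (f≗g (suc n) ℕ.≤-refl)

sumTo-*ˡ : ∀ n c (f : ℕ → ℚ) → sumTo n (λ k → c * f k) ≡ c * sumTo n f
sumTo-*ˡ zero    c f = refl
sumTo-*ˡ (suc n) c f = trans (cong (_+ c * f (suc n)) (sumTo-*ˡ n c f)) (sym (*-distribˡ-+ c (sumTo n f) (f (suc n))))

sumTo-*ʳ : ∀ n (f : ℕ → ℚ) c → sumTo n (λ k → f k * c) ≡ sumTo n f * c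
sumTo-*ʳ zero    f c = refl
sumTo-*ʳ (suc n) f c = trans (cong (_+ f (suc n) * c) (sumTo-*ʳ n f c)) (sym (*-distribʳ-+ c (sumTo n f) (f (suc n))))

sumTo-linear : ∀ n a b (f g : ℕ → ℚ) → sumTo n (λ k → f k * a - g k * b) ≡ sumTo n f * a - sumTo n g * b
sumTo-linear zero    a b f g = refl
sumTo-linear (suc n) a b f g = trans (cong (_+ (f (suc n) * a - g (suc n) * b)) (sumTo-linear n a b f g))
  (regroup (sumTo n f) (sumTo n g) (f (suc n)) (g (suc n)) a b)
  where
  regroup : ∀ x y z w a b → x * a - y * b + (z * a - w * b) ≡ (x + z) * a - (y + w) * b
  regroup = solve-∀ ℚ-ring

sumTo-telescope : ∀ n (G : ℕ → ℚ) → sumTo n (λ k → G (suc k) - G k) ≡ G (suc n) - G 0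
sumTo-telescope zero    G = refl
sumTo-telescope (suc n) G = trans (cong (_+ (G (suc (suc n)) - G (suc n))) (sumTo-telescope n G))
  (collapse (G (suc (suc n))) (G (suc n)) (G 0))
  where
  collapse : ∀ x y z → y - z + (x - y) ≡ x - z
  collapse = solve-∀ ℚ-ring

sumTo-by-parts : ∀ n (G h : ℕ → ℚ) →
  sumTo (suc n) (λ k → (G (suc k) - G k) * h k)
  ≡ G (suc (suc n)) * h (suc n) - G 0 * h 0 - sumTo n (λ k → G (suc k) * (h (suc k) - h k))
sumTo-by-parts zero    G h = regroup (G 0) (G 1) (G 2) (h 0) (h 1)
  where
  regroup : ∀ a b c x y → (b - a) * x + (c - b) * y ≡ c * y - a * x - b * (y - x)
  regroup = solve-∀ ℚ-ring
sumTo-by-parts (suc n) G h = trans (cong (_+ (G (suc (suc (suc n))) - G (suc (suc n))) * h (suc (suc n))) (sumTo-by-parts n G h))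
  (regroup (G (suc (suc (suc n)))) (G (suc (suc n))) (G 0) (h (suc (suc n))) (h (suc n)) (h 0)
    (sumTo n (λ k → G (suc k) * (h (suc k) - h k))))
  where
  regroup : ∀ a b c x y z s → b * y - c * z - s + (a - b) * x ≡ a * x - c * z - (s + b * (x - y))
  regroup = solve-∀ ℚ-ring

-- The summand and its contiguous relations

saalTerm : (N M V A L k : ℕ) → ℚ
saalTerm N M V A L k = ((N C k) ℕ.* ((L ℕ.+ k) C k) ℕ.* (M C k)) ÷ℕ (((V ℕ.+ k) C k) ℕ.* ((A ℕ.+ k) C k))

saalSum : (N M V A L : ℕ) → ℚ
saalSum N M V A L = sumTo N (saalTerm N M V A L)

denominator-nonZero : ∀ V A k → NonZero (((V ℕ.+ k) C k) ℕ.* ((A ℕ.+ k) C k))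
denominator-nonZero V A k = ℕ.m*n≢0 _ _ {{C-nonZero V k}} {{C-nonZero A k}}

saalTerm-*-denominator : ∀ N M V A L k →
  saalTerm N M V A L k * (⟦ (V ℕ.+ k) C k ⟧ * ⟦ (A ℕ.+ k) C k ⟧) ≡ ⟦ N C k ⟧ * ⟦ (L ℕ.+ k) C k ⟧ * ⟦ M C k ⟧
saalTerm-*-denominator N M V A L k = begin
  saalTerm N M V A L k * (⟦ cV ⟧ * ⟦ cA ⟧)  ≡⟨ cong (saalTerm N M V A L k *_) (⟦*⟧ cV cA) ⟨
  saalTerm N M V A L k * ⟦ cV ℕ.* cA ⟧      ≡⟨ ÷ℕ-*-cancel _ (cV ℕ.* cA) {{denominator-nonZero V A k}} ⟩
  ⟦ cN ℕ.* cL ℕ.* cM ⟧                      ≡⟨ ⟦*⟧ (cN ℕ.* cL) cM ⟩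
  ⟦ cN ℕ.* cL ⟧ * ⟦ cM ⟧                    ≡⟨ cong (_* ⟦ cM ⟧) (⟦*⟧ cN cL) ⟩
  ⟦ cN ⟧ * ⟦ cL ⟧ * ⟦ cM ⟧                  ∎
  where
  cN = N C k
  cL = (L ℕ.+ k) C k
  cM = M C k
  cV = (V ℕ.+ k) C k
  cA = (A ℕ.+ k) C k

saalTerm-ratio : ∀ N M V A L k N′ M′ V′ A′ L′ k′ (σ₁ ρ₁ σ₂ ρ₂ σ₃ ρ₃ σ₄ ρ₄ σ₅ ρ₅ : ℚ) →
  σ₁ * ⟦ N′ C k′ ⟧ ≡ ρ₁ * ⟦ N C k ⟧ →
  σ₂ * ⟦ (L′ ℕ.+ k′) C k′ ⟧ ≡ ρ₂ * ⟦ (L ℕ.+ k) C k ⟧ →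
  σ₃ * ⟦ M′ C k′ ⟧ ≡ ρ₃ * ⟦ M C k ⟧ →
  σ₄ * ⟦ (V′ ℕ.+ k′) C k′ ⟧ ≡ ρ₄ * ⟦ (V ℕ.+ k) C k ⟧ →
  σ₅ * ⟦ (A′ ℕ.+ k′) C k′ ⟧ ≡ ρ₅ * ⟦ (A ℕ.+ k) C k ⟧ →
  saalTerm N′ M′ V′ A′ L′ k′ * (σ₁ * σ₂ * σ₃ * (ρ₄ * ρ₅)) ≡ saalTerm N M V A L k * (ρ₁ * ρ₂ * ρ₃ * (σ₄ * σ₅))
saalTerm-ratio N M V A L k N′ M′ V′ A′ L′ k′ σ₁ ρ₁ σ₂ ρ₂ σ₃ ρ₃ σ₄ ρ₄ σ₅ ρ₅ hN hL hM hV hA =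
  *-cancelʳ-⟦⟧² cV cA {{C-nonZero V k}} {{C-nonZero A k}}
      (quotient-ratio (saalTerm N M V A L k) (saalTerm N′ M′ V′ A′ L′ k′)
        (⟦ cN ⟧ * ⟦ cL ⟧ * ⟦ cM ⟧) (⟦ cN′ ⟧ * ⟦ cL′ ⟧ * ⟦ cM′ ⟧) (⟦ cV ⟧ * ⟦ cA ⟧) (⟦ cV′ ⟧ * ⟦ cA′ ⟧)
        (σ₁ * σ₂ * σ₃) (ρ₁ * ρ₂ * ρ₃) (σ₄ * σ₅) (ρ₄ * ρ₅)
        (saalTerm-*-denominator N M V A L k) (saalTerm-*-denominator N′ M′ V′ A′ L′ k′)
        (*-ratio (σ₁ * σ₂) (ρ₁ * ρ₂) (⟦ cN ⟧ * ⟦ cL ⟧) (⟦ cN′ ⟧ * ⟦ cL′ ⟧) σ₃ ρ₃ ⟦ cM ⟧ ⟦ cM′ ⟧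
          (*-ratio σ₁ ρ₁ ⟦ cN ⟧ ⟦ cN′ ⟧ σ₂ ρ₂ ⟦ cL ⟧ ⟦ cL′ ⟧ hN hL) hM)
        (*-ratio σ₄ ρ₄ ⟦ cV ⟧ ⟦ cV′ ⟧ σ₅ ρ₅ ⟦ cA ⟧ ⟦ cA′ ⟧ hV hA))
  where
  cN = N C k
  cL = (L ℕ.+ k) C k
  cM = M C k
  cV = (V ℕ.+ k) C k
  cA = (A ℕ.+ k) C k
  cN′ = N′ C k′
  cL′ = (L′ ℕ.+ k′) C k′
  cM′ = M′ C k′
  cV′ = (V′ ℕ.+ k′) C k′
  cA′ = (A′ ℕ.+ k′) C k′

saalTerm-suc-k : ∀ N M V A L k →
  saalTerm N M V A L (suc k) * ((1ℚ + ⟦ k ⟧) * (1ℚ + ⟦ V ⟧ + ⟦ k ⟧) * (1ℚ + ⟦ A ⟧ + ⟦ k ⟧))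
  ≡ saalTerm N M V A L k * ((⟦ N ⟧ - ⟦ k ⟧) * (⟦ M ⟧ - ⟦ k ⟧) * (1ℚ + ⟦ L ⟧ + ⟦ k ⟧))
saalTerm-suc-k N M V A L k = cancel-square (saalTerm N M V A L (suc k)) (saalTerm N M V A L k)
  (1 ÷ℕ suc k) (1ℚ + ⟦ k ⟧) (1ℚ + ⟦ V ⟧ + ⟦ k ⟧) (1ℚ + ⟦ A ⟧ + ⟦ k ⟧)
  (⟦ N ⟧ - ⟦ k ⟧) (⟦ M ⟧ - ⟦ k ⟧) (1ℚ + ⟦ L ⟧ + ⟦ k ⟧) (1÷ℕ-inverse-suc k)
  (saalTerm-ratio N M V A L k N M V A L (suc k)
    (1ℚ + ⟦ k ⟧) (⟦ N ⟧ - ⟦ k ⟧) (1ℚ + ⟦ k ⟧) (1ℚ + ⟦ L ⟧ + ⟦ k ⟧) (1ℚ + ⟦ k ⟧) (⟦ M ⟧ - ⟦ k ⟧)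
    (1ℚ + ⟦ k ⟧) (1ℚ + ⟦ V ⟧ + ⟦ k ⟧) (1ℚ + ⟦ k ⟧) (1ℚ + ⟦ A ⟧ + ⟦ k ⟧)
    (C[n,k]-suc-k N k) (C[x+k,k]-suc-k L k) (C[n,k]-suc-k M k) (C[x+k,k]-suc-k V k) (C[x+k,k]-suc-k A k))
  where
  cancel-square : ∀ t′ t i s p q a b c → i * s ≡ 1ℚ →
    t′ * (s * s * s * (p * q)) ≡ t * (a * c * b * (s * s)) → t′ * (s * p * q) ≡ t * (a * b * c)
  cancel-square t′ t i s p q a b c is≡1 e = *-cancelʳ-invertible i is≡1 (*-cancelʳ-invertible i is≡1
    (linear-combination 1ℚ e (solve (t′ ∷ t ∷ s ∷ p ∷ q ∷ a ∷ b ∷ c ∷ []) ℚ-ring)))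

saalTerm-suc-N : ∀ N M V A L k →
  saalTerm (suc N) M V A (suc L) k * ((1ℚ + ⟦ N ⟧ - ⟦ k ⟧) * (1ℚ + ⟦ L ⟧))
  ≡ saalTerm N M V A L k * ((1ℚ + ⟦ N ⟧) * (1ℚ + ⟦ L ⟧ + ⟦ k ⟧))
saalTerm-suc-N N M V A L k = drop-units (saalTerm (suc N) M V A (suc L) k) (saalTerm N M V A L k)
  (1ℚ + ⟦ N ⟧ - ⟦ k ⟧) (1ℚ + ⟦ L ⟧) (1ℚ + ⟦ N ⟧) (1ℚ + ⟦ L ⟧ + ⟦ k ⟧)
  (saalTerm-ratio N M V A L k (suc N) M V A (suc L) k
    (1ℚ + ⟦ N ⟧ - ⟦ k ⟧) (1ℚ + ⟦ N ⟧) (1ℚ + ⟦ L ⟧) (1ℚ + ⟦ L ⟧ + ⟦ k ⟧) 1ℚ 1ℚ 1ℚ 1ℚ 1ℚ 1ℚ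
    (C[n,k]-suc-n N k) (C[x+k,k]-suc-x L k) refl refl refl)
  where
  drop-units : ∀ t′ t a b c d → t′ * (a * b * 1ℚ * (1ℚ * 1ℚ)) ≡ t * (c * d * 1ℚ * (1ℚ * 1ℚ)) →
               t′ * (a * b) ≡ t * (c * d)
  drop-units t′ t a b c d e = linear-combination 1ℚ e (solve (t′ ∷ t ∷ a ∷ b ∷ c ∷ d ∷ []) ℚ-ring)

saalTerm-exchange-N-A : ∀ N M V A L k →
  saalTerm (suc N) M V A L k * ((1ℚ + ⟦ N ⟧ - ⟦ k ⟧) * (1ℚ + ⟦ A ⟧))
  ≡ saalTerm N M V (suc A) L k * ((1ℚ + ⟦ N ⟧) * (1ℚ + ⟦ A ⟧ + ⟦ k ⟧))
saalTerm-exchange-N-A N M V A L k = drop-units (saalTerm (suc N) M V A L k) (saalTerm N M V (suc A) L k)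
  (1ℚ + ⟦ N ⟧ - ⟦ k ⟧) (1ℚ + ⟦ A ⟧) (1ℚ + ⟦ N ⟧) (1ℚ + ⟦ A ⟧ + ⟦ k ⟧)
  (saalTerm-ratio N M V (suc A) L k (suc N) M V A L k
    (1ℚ + ⟦ N ⟧ - ⟦ k ⟧) (1ℚ + ⟦ N ⟧) 1ℚ 1ℚ 1ℚ 1ℚ 1ℚ 1ℚ (1ℚ + ⟦ A ⟧ + ⟦ k ⟧) (1ℚ + ⟦ A ⟧)
    (C[n,k]-suc-n N k) refl refl refl (sym (C[x+k,k]-suc-x A k)))
  where
  drop-units : ∀ t′ t a b c d → t′ * (a * 1ℚ * 1ℚ * (1ℚ * b)) ≡ t * (c * 1ℚ * 1ℚ * (1ℚ * d)) →
               t′ * (a * b) ≡ t * (c * d)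
  drop-units t′ t a b c d e = linear-combination 1ℚ e (solve (t′ ∷ t ∷ a ∷ b ∷ c ∷ d ∷ []) ℚ-ring)

saalTerm-vanishes : ∀ N M V A L → saalTerm N M V A L (suc N) ≡ 0ℚ
saalTerm-vanishes N M V A L = *-cancelʳ-⟦⟧² cV cA {{C-nonZero V (suc N)}} {{C-nonZero A (suc N)}} (begin
  saalTerm N M V A L (suc N) * (⟦ cV ⟧ * ⟦ cA ⟧)  ≡⟨ saalTerm-*-denominator N M V A L (suc N) ⟩
  ⟦ N C suc N ⟧ * ⟦ cL ⟧ * ⟦ cM ⟧                ≡⟨ cong (λ c → ⟦ c ⟧ * ⟦ cL ⟧ * ⟦ cM ⟧) (k>n⇒nCk≡0 (ℕ.n<1+n N)) ⟩
  ⟦ 0 ⟧ * ⟦ cL ⟧ * ⟦ cM ⟧                        ≡⟨ cong (λ z → z * ⟦ cL ⟧ * ⟦ cM ⟧) ⟦0⟧ ⟩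
  0ℚ * ⟦ cL ⟧ * ⟦ cM ⟧                           ≡⟨ 0*x*y≡0*z ⟦ cL ⟧ ⟦ cM ⟧ (⟦ cV ⟧ * ⟦ cA ⟧) ⟩
  0ℚ * (⟦ cV ⟧ * ⟦ cA ⟧)                         ∎)
  where
  cL = (L ℕ.+ suc N) C suc N
  cM = M C suc N
  cV = (V ℕ.+ suc N) C suc N
  cA = (A ℕ.+ suc N) C suc N
  0*x*y≡0*z : ∀ x y z → 0ℚ * x * y ≡ 0ℚ * z
  0*x*y≡0*z = solve-∀ ℚ-ring

-- The WZ pair and the Pfaff–Saalschütz sum

wzCertificate : (N M V A L : ℕ) → ℕ → ℚ
wzCertificate N M V A L zero    = 0ℚ
wzCertificate N M V A L (suc k) =
  - (⟦ suc L ⟧ + ⟦ suc N ⟧) * saalTerm (suc N) M V A (suc L) k * ((⟦ suc N ⟧ - ⟦ k ⟧) * (⟦ M ⟧ - ⟦ k ⟧))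

wz-pair : ∀ N M V A L → L ≡ V ℕ.+ A ℕ.+ M ℕ.+ N → ∀ k →
  saalTerm (suc N) M V A (suc L) k * ((1ℚ + ⟦ V ⟧ + ⟦ N ⟧) * (1ℚ + ⟦ A ⟧ + ⟦ N ⟧) * (1ℚ + ⟦ N ⟧))
  - saalTerm N M V A L k * ((1ℚ + ⟦ A ℕ.+ M ⟧ + ⟦ N ⟧) * (1ℚ + ⟦ M ℕ.+ V ⟧ + ⟦ N ⟧) * (1ℚ + ⟦ N ⟧))
  ≡ wzCertificate N M V A L (suc k) - wzCertificate N M V A L k
wz-pair N M V A L balanced zero = identity ⟦ N ⟧ ⟦ M ⟧ ⟦ V ⟧ ⟦ A ⟧ ⟦ L ⟧ ⟦ A ℕ.+ M ⟧ ⟦ M ℕ.+ V ⟧ ⟦ suc N ⟧ ⟦ suc L ⟧ ⟦ 0 ⟧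
  (trans (cong ⟦_⟧ balanced) (⟦+⟧₄ V A M N)) (⟦+⟧ A M) (⟦+⟧ M V) (⟦suc⟧ N) (⟦suc⟧ L) ⟦0⟧
  where
  identity : ∀ n m v a l am mv sN sL z → l ≡ v + a + m + n → am ≡ a + m → mv ≡ m + v →
    sN ≡ 1ℚ + n → sL ≡ 1ℚ + l → z ≡ 0ℚ →
    1ℚ * ((1ℚ + v + n) * (1ℚ + a + n) * (1ℚ + n)) - 1ℚ * ((1ℚ + am + n) * (1ℚ + mv + n) * (1ℚ + n))
    ≡ - (sL + sN) * 1ℚ * ((sN - z) * (m - z)) - 0ℚ
  identity n m v a _ _ _ _ _ _ refl refl refl refl refl refl = solve (n ∷ m ∷ v ∷ a ∷ []) ℚ-ring
-- Eliminating the previous term needs the coefficient (L+N+2)/(L+j+2), so both sides are first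
-- multiplied by L+j+2.
wz-pair N M V A L balanced (suc j) = *-cancelʳ-⟦⟧ (suc L ℕ.+ suc j) (identity
  ⟦ N ⟧ ⟦ M ⟧ ⟦ V ⟧ ⟦ A ⟧ ⟦ L ⟧ ⟦ A ℕ.+ M ⟧ ⟦ M ℕ.+ V ⟧ ⟦ suc N ⟧ ⟦ suc L ⟧ ⟦ j ⟧ ⟦ suc j ⟧ ⟦ suc L ℕ.+ suc j ⟧
  (saalTerm (suc N) M V A (suc L) (suc j)) (saalTerm (suc N) M V A (suc L) j) (saalTerm N M V A L (suc j))
  (trans (cong ⟦_⟧ balanced) (⟦+⟧₄ V A M N)) (⟦+⟧ A M) (⟦+⟧ M V) (⟦suc⟧ N) (⟦suc⟧ L) (⟦suc⟧ j) (⟦+⟧ (suc L) (suc j))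
  (saalTerm-suc-k (suc N) M V A (suc L) j) (saalTerm-suc-N N M V A L (suc j)))
  where
  identity : ∀ n m v a l am mv sN sL j sj K X Y W → l ≡ v + a + m + n → am ≡ a + m → mv ≡ m + v →
    sN ≡ 1ℚ + n → sL ≡ 1ℚ + l → sj ≡ 1ℚ + j → K ≡ sL + sj →
    X * ((1ℚ + j) * (1ℚ + v + j) * (1ℚ + a + j)) ≡ Y * ((sN - j) * (m - j) * (1ℚ + sL + j)) →
    X * ((1ℚ + n - sj) * (1ℚ + l)) ≡ W * ((1ℚ + n) * (1ℚ + l + sj)) →
    (X * ((1ℚ + v + n) * (1ℚ + a + n) * (1ℚ + n)) - W * ((1ℚ + am + n) * (1ℚ + mv + n) * (1ℚ + n))) * K
    ≡ (- (sL + sN) * X * ((sN - sj) * (m - sj)) - - (sL + sN) * Y * ((sN - j) * (m - j))) * K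
  identity n m v a _ _ _ _ _ j _ _ X Y W refl refl refl refl refl refl refl suc-k suc-N =
    linear-combination ((1ℚ + (a + m) + n) * (1ℚ + (m + v) + n)) suc-N
      (linear-combination (1ℚ + (v + a + m + n) + (1ℚ + n)) suc-k
        (solve (n ∷ m ∷ v ∷ a ∷ j ∷ X ∷ Y ∷ W ∷ []) ℚ-ring))

wz-sum : ∀ N M V A L → L ≡ V ℕ.+ A ℕ.+ M ℕ.+ N →
  saalSum (suc N) M V A (suc L) * ((1ℚ + ⟦ V ⟧ + ⟦ N ⟧) * (1ℚ + ⟦ A ⟧ + ⟦ N ⟧))
  ≡ saalSum N M V A L * ((1ℚ + ⟦ A ℕ.+ M ⟧ + ⟦ N ⟧) * (1ℚ + ⟦ M ℕ.+ V ⟧ + ⟦ N ⟧))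
wz-sum N M V A L balanced = cancel S′ S (1ℚ + ⟦ V ⟧ + ⟦ N ⟧) (1ℚ + ⟦ A ⟧ + ⟦ N ⟧)
  (1ℚ + ⟦ A ℕ.+ M ⟧ + ⟦ N ⟧) (1ℚ + ⟦ M ℕ.+ V ⟧ + ⟦ N ⟧) (1ℚ + ⟦ N ⟧) (1 ÷ℕ suc N) (1÷ℕ-inverse-suc N) (begin
    S′ * a - S * b                                   ≡⟨ cong (λ z → S′ * a - z * b) (+-identityʳ S) ⟨
    S′ * a - (S + 0ℚ) * b                            ≡⟨ cong (λ z → S′ * a - (S + z) * b) (saalTerm-vanishes N M V A L) ⟨
    S′ * a - sumTo (suc N) t * b                     ≡⟨ sumTo-linear (suc N) a b t′ t ⟨
    sumTo (suc N) (λ k → t′ k * a - t k * b)         ≡⟨ sumTo-cong (suc N) (λ k _ → wz-pair N M V A L balanced k) ⟩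
    sumTo (suc N) (λ k → G (suc k) - G k)            ≡⟨ sumTo-telescope (suc N) G ⟩
    G (suc (suc N)) - 0ℚ                             ≡⟨ vanishing-factor (⟦ suc L ⟧ + ⟦ suc N ⟧) (t′ (suc N)) ⟦ suc N ⟧ (⟦ M ⟧ - ⟦ suc N ⟧) ⟩
    0ℚ                                               ∎)
  where
  t′ = saalTerm (suc N) M V A (suc L)
  t = saalTerm N M V A L
  G = wzCertificate N M V A L
  S′ = saalSum (suc N) M V A (suc L)
  S = saalSum N M V A L
  a = (1ℚ + ⟦ V ⟧ + ⟦ N ⟧) * (1ℚ + ⟦ A ⟧ + ⟦ N ⟧) * (1ℚ + ⟦ N ⟧)
  b = (1ℚ + ⟦ A ℕ.+ M ⟧ + ⟦ N ⟧) * (1ℚ + ⟦ M ℕ.+ V ⟧ + ⟦ N ⟧) * (1ℚ + ⟦ N ⟧)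
  vanishing-factor : ∀ c u s m → - c * u * ((s - s) * m) - 0ℚ ≡ 0ℚ
  vanishing-factor = solve-∀ ℚ-ring
  cancel : ∀ x y p q p′ q′ s i → i * s ≡ 1ℚ → x * (p * q * s) - y * (p′ * q′ * s) ≡ 0ℚ → x * (p * q) ≡ y * (p′ * q′)
  cancel x y p q p′ q′ s i is≡1 e = *-cancelʳ-invertible i is≡1
    (linear-combination 1ℚ e (solve (x ∷ y ∷ p ∷ q ∷ p′ ∷ q′ ∷ s ∷ []) ℚ-ring))

saalschütz : ∀ N M V A L → L ≡ V ℕ.+ A ℕ.+ M ℕ.+ N →
  saalSum N M V A L * (⟦ (V ℕ.+ N) C N ⟧ * ⟦ (A ℕ.+ N) C N ⟧) ≡ ⟦ (A ℕ.+ M ℕ.+ N) C N ⟧ * ⟦ (M ℕ.+ V ℕ.+ N) C N ⟧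
saalschütz zero    M V A L _ = *-identityˡ (⟦ 1 ⟧ * ⟦ 1 ⟧)
saalschütz (suc N) M V A _ refl rewrite ℕ.+-suc (V ℕ.+ A ℕ.+ M) N = recurrence-transfer
  (saalSum N M V A L) (saalSum (suc N) M V A (suc L))
  (⟦ (V ℕ.+ N) C N ⟧ * ⟦ (A ℕ.+ N) C N ⟧) (⟦ (V ℕ.+ suc N) C suc N ⟧ * ⟦ (A ℕ.+ suc N) C suc N ⟧)
  (⟦ (A ℕ.+ M ℕ.+ N) C N ⟧ * ⟦ (M ℕ.+ V ℕ.+ N) C N ⟧) (⟦ (A ℕ.+ M ℕ.+ suc N) C suc N ⟧ * ⟦ (M ℕ.+ V ℕ.+ suc N) C suc N ⟧)
  (s * s) (P * Q) (R * T) (1 ÷ℕ suc N * (1 ÷ℕ suc N)) (product-inverse (1 ÷ℕ suc N) s (1 ÷ℕ suc N) s (1÷ℕ-inverse-suc N) (1÷ℕ-inverse-suc N))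
  (saalschütz N M V A L refl)
  (*-ratio s P ⟦ (V ℕ.+ N) C N ⟧ ⟦ (V ℕ.+ suc N) C suc N ⟧ s Q ⟦ (A ℕ.+ N) C N ⟧ ⟦ (A ℕ.+ suc N) C suc N ⟧
    (C[x+k,k]-suc-k V N) (C[x+k,k]-suc-k A N))
  (*-ratio s R ⟦ (A ℕ.+ M ℕ.+ N) C N ⟧ ⟦ (A ℕ.+ M ℕ.+ suc N) C suc N ⟧ s T ⟦ (M ℕ.+ V ℕ.+ N) C N ⟧ ⟦ (M ℕ.+ V ℕ.+ suc N) C suc N ⟧
    (C[x+k,k]-suc-k (A ℕ.+ M) N) (C[x+k,k]-suc-k (M ℕ.+ V) N))
  (wz-sum N M V A L refl)
  where
  L = V ℕ.+ A ℕ.+ M ℕ.+ N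
  s = 1ℚ + ⟦ N ⟧
  P = 1ℚ + ⟦ V ⟧ + ⟦ N ⟧
  Q = 1ℚ + ⟦ A ⟧ + ⟦ N ⟧
  R = 1ℚ + ⟦ A ℕ.+ M ⟧ + ⟦ N ⟧
  T = 1ℚ + ⟦ M ℕ.+ V ⟧ + ⟦ N ⟧

-- The harmonic sum

-- M ∸ k is truncated subtraction; only k ≤ N ≤ M is ever used.
harmonicGap : ℕ → ℕ → ℕ → ℚ
harmonicGap M A k = H (M ℕ.∸ k) - H (A ℕ.+ k)

harmonicSum : (N M V A L : ℕ) → ℚ
harmonicSum N M V A L = sumTo N (λ k → saalTerm N M V A L k * harmonicGap M A k)

M∸j≡1+M∸[1+j] : ∀ {M j} → j < M → M ℕ.∸ j ≡ suc (M ℕ.∸ suc j)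
M∸j≡1+M∸[1+j] = ℕ.+-∸-assoc 1

harmonicGap-step : ∀ M A j → j < M →
  harmonicGap M A (suc j) - harmonicGap M A j ≡ - (1 ÷ℕ suc (M ℕ.∸ suc j) + 1 ÷ℕ suc (A ℕ.+ j))
harmonicGap-step M A j j<M rewrite M∸j≡1+M∸[1+j] j<M | ℕ.+-suc A j =
  difference (H (M ℕ.∸ suc j)) (H (A ℕ.+ j)) (1 ÷ℕ suc (M ℕ.∸ suc j)) (1 ÷ℕ suc (A ℕ.+ j))
  where
  difference : ∀ x y p q → x - (y + q) - (x + p - y) ≡ - (p + q)
  difference = solve-∀ ℚ-ring

-- (M-j)(1/(M-j) + 1/(A+1+j)) = (A+M+1)/(A+1+j), and trading N+1 for A+1 in the summand absorbs
-- the remaining denominator.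
certificate-*-gap : ∀ N M V A L j → j < M →
  wzCertificate N M V A L (suc j) * (harmonicGap M A (suc j) - harmonicGap M A j) * (1ℚ + ⟦ A ⟧)
  ≡ (⟦ suc L ⟧ + ⟦ suc N ⟧) * (1ℚ + ⟦ A ℕ.+ M ⟧) * (1ℚ + ⟦ N ⟧) * saalTerm N M V (suc A) (suc L) j
certificate-*-gap N M V A L j j<M = begin
  wzCertificate N M V A L (suc j) * (harmonicGap M A (suc j) - harmonicGap M A j) * (1ℚ + ⟦ A ⟧)
    ≡⟨ cong (λ z → wzCertificate N M V A L (suc j) * z * (1ℚ + ⟦ A ⟧)) (harmonicGap-step M A j j<M) ⟩
  wzCertificate N M V A L (suc j) * - (iM + iA) * (1ℚ + ⟦ A ⟧)
    ≡⟨ identity (⟦ suc L ⟧ + ⟦ suc N ⟧) ⟦ N ⟧ ⟦ M ⟧ ⟦ A ⟧ ⟦ A ℕ.+ M ⟧ ⟦ j ⟧ ⟦ suc N ⟧ iM iA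
         (saalTerm (suc N) M V A (suc L) j) (saalTerm N M V (suc A) (suc L) j)
         (⟦+⟧ A M) (⟦suc⟧ N) inverse-M (1÷ℕ-inverse-suc+ A j) (saalTerm-exchange-N-A N M V A (suc L) j) ⟩
  (⟦ suc L ⟧ + ⟦ suc N ⟧) * (1ℚ + ⟦ A ℕ.+ M ⟧) * (1ℚ + ⟦ N ⟧) * saalTerm N M V (suc A) (suc L) j
    ∎
  where
  iM = 1 ÷ℕ suc (M ℕ.∸ suc j)
  iA = 1 ÷ℕ suc (A ℕ.+ j)
  inverse-M : iM * (⟦ M ⟧ - ⟦ j ⟧) ≡ 1ℚ
  inverse-M = trans (cong (iM *_) (trans (sym (⟦∸⟧ (ℕ.<⇒≤ j<M))) (cong ⟦_⟧ (M∸j≡1+M∸[1+j] j<M))))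
                    (1÷ℕ-inverse (suc (M ℕ.∸ suc j)))
  identity : ∀ c n m a am j sN iM iA X Z → am ≡ a + m → sN ≡ 1ℚ + n →
    iM * (m - j) ≡ 1ℚ → iA * (1ℚ + a + j) ≡ 1ℚ →
    X * ((1ℚ + n - j) * (1ℚ + a)) ≡ Z * ((1ℚ + n) * (1ℚ + a + j)) →
    - c * X * ((sN - j) * (m - j)) * - (iM + iA) * (1ℚ + a) ≡ c * (1ℚ + am) * (1ℚ + n) * Z
  identity c n m a _ j _ iM iA X Z refl refl inv-M inv-A exchange =
    linear-combination (c * iA * (1ℚ + a + m)) exchange
      (linear-combination (c * (1ℚ + a + m) * (1ℚ + n) * Z - c * X * (1ℚ + n - j) * (1ℚ + a)) inv-A
        (linear-combination (c * X * (1ℚ + n - j) * (1ℚ + a)) inv-M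
          (solve (c ∷ n ∷ m ∷ a ∷ j ∷ iM ∷ iA ∷ X ∷ Z ∷ []) ℚ-ring)))

harmonic-wz-sum : ∀ N M V A L → L ≡ V ℕ.+ A ℕ.+ M ℕ.+ N →
  harmonicSum (suc N) M V A (suc L) * ((1ℚ + ⟦ V ⟧ + ⟦ N ⟧) * (1ℚ + ⟦ A ⟧ + ⟦ N ⟧) * (1ℚ + ⟦ N ⟧))
  - harmonicSum N M V A L * ((1ℚ + ⟦ A ℕ.+ M ⟧ + ⟦ N ⟧) * (1ℚ + ⟦ M ℕ.+ V ⟧ + ⟦ N ⟧) * (1ℚ + ⟦ N ⟧))
  ≡ - sumTo N (λ j → wzCertificate N M V A L (suc j) * (harmonicGap M A (suc j) - harmonicGap M A j))
harmonic-wz-sum N M V A L balanced = begin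
  H′ * a - H₀ * b
    ≡⟨ cong (λ z → H′ * a - z * b) (+-identityʳ H₀) ⟨
  H′ * a - (H₀ + 0ℚ) * b
    ≡⟨ cong (λ z → H′ * a - (H₀ + z) * b) (trans (cong (_* h (suc N)) (saalTerm-vanishes N M V A L)) (*-zeroˡ (h (suc N)))) ⟨
  H′ * a - sumTo (suc N) (λ k → t k * h k) * b
    ≡⟨ sumTo-linear (suc N) a b (λ k → t′ k * h k) (λ k → t k * h k) ⟨
  sumTo (suc N) (λ k → t′ k * h k * a - t k * h k * b)
    ≡⟨ sumTo-cong (suc N) (λ k _ → trans (factor-out (t′ k) (t k) (h k) a b) (cong (_* h k) (wz-pair N M V A L balanced k))) ⟩
  sumTo (suc N) (λ k → (G (suc k) - G k) * h k)
    ≡⟨ sumTo-by-parts N G h ⟩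
  G (suc (suc N)) * h (suc N) - 0ℚ * h 0 - sumTo N (λ j → G (suc j) * (h (suc j) - h j))
    ≡⟨ boundary-vanishes (⟦ suc L ⟧ + ⟦ suc N ⟧) (t′ (suc N)) ⟦ suc N ⟧ (⟦ M ⟧ - ⟦ suc N ⟧) (h (suc N)) (h 0) _ ⟩
  - sumTo N (λ j → G (suc j) * (h (suc j) - h j))
    ∎
  where
  t′ = saalTerm (suc N) M V A (suc L)
  t = saalTerm N M V A L
  h = harmonicGap M A
  G = wzCertificate N M V A L
  H′ = harmonicSum (suc N) M V A (suc L)
  H₀ = harmonicSum N M V A L
  a = (1ℚ + ⟦ V ⟧ + ⟦ N ⟧) * (1ℚ + ⟦ A ⟧ + ⟦ N ⟧) * (1ℚ + ⟦ N ⟧)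
  b = (1ℚ + ⟦ A ℕ.+ M ⟧ + ⟦ N ⟧) * (1ℚ + ⟦ M ℕ.+ V ⟧ + ⟦ N ⟧) * (1ℚ + ⟦ N ⟧)
  factor-out : ∀ x y z a b → x * z * a - y * z * b ≡ (x * a - y * b) * z
  factor-out = solve-∀ ℚ-ring
  boundary-vanishes : ∀ c u s m x y S → - c * u * ((s - s) * m) * x - 0ℚ * y - S ≡ - S
  boundary-vanishes = solve-∀ ℚ-ring

harmonic-recurrence : ∀ N M V A L → L ≡ V ℕ.+ A ℕ.+ M ℕ.+ N → suc N ≤ M →
  (harmonicSum (suc N) M V A (suc L) * ((1ℚ + ⟦ V ⟧ + ⟦ N ⟧) * (1ℚ + ⟦ A ⟧ + ⟦ N ⟧) * (1ℚ + ⟦ N ⟧))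
   - harmonicSum N M V A L * ((1ℚ + ⟦ A ℕ.+ M ⟧ + ⟦ N ⟧) * (1ℚ + ⟦ M ℕ.+ V ⟧ + ⟦ N ⟧) * (1ℚ + ⟦ N ⟧)))
    * (1ℚ + ⟦ A ⟧)
  ≡ - ((⟦ suc L ⟧ + ⟦ suc N ⟧) * (1ℚ + ⟦ A ℕ.+ M ⟧) * (1ℚ + ⟦ N ⟧) * saalSum N M V (suc A) (suc L))
harmonic-recurrence N M V A L balanced 1+N≤M = begin
  (harmonicSum (suc N) M V A (suc L) * a - harmonicSum N M V A L * b) * (1ℚ + ⟦ A ⟧)
    ≡⟨ cong (_* (1ℚ + ⟦ A ⟧)) (harmonic-wz-sum N M V A L balanced) ⟩
  - sumTo N g * (1ℚ + ⟦ A ⟧)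
    ≡⟨ neg-distribˡ-* (sumTo N g) (1ℚ + ⟦ A ⟧) ⟨
  - (sumTo N g * (1ℚ + ⟦ A ⟧))
    ≡⟨ cong -_ (sumTo-*ʳ N g (1ℚ + ⟦ A ⟧)) ⟨
  - sumTo N (λ j → g j * (1ℚ + ⟦ A ⟧))
    ≡⟨ cong -_ (sumTo-cong N (λ j j≤N → certificate-*-gap N M V A L j (ℕ.<-≤-trans (s≤s j≤N) 1+N≤M))) ⟩
  - sumTo N (λ j → κ * saalTerm N M V (suc A) (suc L) j)
    ≡⟨ cong -_ (sumTo-*ˡ N κ (saalTerm N M V (suc A) (suc L))) ⟩
  - (κ * saalSum N M V (suc A) (suc L))
    ∎
  where
  a = (1ℚ + ⟦ V ⟧ + ⟦ N ⟧) * (1ℚ + ⟦ A ⟧ + ⟦ N ⟧) * (1ℚ + ⟦ N ⟧)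
  b = (1ℚ + ⟦ A ℕ.+ M ⟧ + ⟦ N ⟧) * (1ℚ + ⟦ M ℕ.+ V ⟧ + ⟦ N ⟧) * (1ℚ + ⟦ N ⟧)
  g = λ j → wzCertificate N M V A L (suc j) * (harmonicGap M A (suc j) - harmonicGap M A j)
  κ = (⟦ suc L ⟧ + ⟦ suc N ⟧) * (1ℚ + ⟦ A ℕ.+ M ⟧) * (1ℚ + ⟦ N ⟧)

harmonicCorrection : (N M V A : ℕ) → ℚ
harmonicCorrection N M V A = H (M ℕ.+ V) - H (M ℕ.+ V ℕ.+ N) + H M - H (A ℕ.+ N)

harmonicCorrection-suc : ∀ N M V A → harmonicCorrection (suc N) M V A
  ≡ harmonicCorrection N M V A - 1 ÷ℕ suc (M ℕ.+ V ℕ.+ N) - 1 ÷ℕ suc (A ℕ.+ N)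
harmonicCorrection-suc N M V A rewrite ℕ.+-suc (M ℕ.+ V) N | ℕ.+-suc A N =
  regroup (H (M ℕ.+ V)) (H (M ℕ.+ V ℕ.+ N)) (H M) (H (A ℕ.+ N)) (1 ÷ℕ suc (M ℕ.+ V ℕ.+ N)) (1 ÷ℕ suc (A ℕ.+ N))
  where
  regroup : ∀ a b c d p q → a - (b + p) + c - (d + q) ≡ a - b + c - d - p - q
  regroup = solve-∀ ℚ-ring

[L+1]+[N+1]≡[A+N+1]+[M+V+N+1] : ∀ N M V A L → L ≡ V ℕ.+ A ℕ.+ M ℕ.+ N →
  ⟦ suc L ⟧ + ⟦ suc N ⟧ ≡ (1ℚ + ⟦ A ⟧ + ⟦ N ⟧) + (1ℚ + ⟦ M ℕ.+ V ⟧ + ⟦ N ⟧)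
[L+1]+[N+1]≡[A+N+1]+[M+V+N+1] N M V A L refl = begin
  ⟦ suc L ⟧ + ⟦ suc N ⟧                            ≡⟨ ⟦+⟧ (suc L) (suc N) ⟨
  ⟦ suc L ℕ.+ suc N ⟧                              ≡⟨ cong ⟦_⟧ (rearrange V A M N) ⟩
  ⟦ suc (A ℕ.+ N) ℕ.+ suc (M ℕ.+ V ℕ.+ N) ⟧        ≡⟨ ⟦+⟧ (suc (A ℕ.+ N)) (suc (M ℕ.+ V ℕ.+ N)) ⟩
  ⟦ suc (A ℕ.+ N) ⟧ + ⟦ suc (M ℕ.+ V ℕ.+ N) ⟧      ≡⟨ cong₂ _+_ (⟦suc+⟧ A N) (⟦suc+⟧ (M ℕ.+ V) N) ⟩
  (1ℚ + ⟦ A ⟧ + ⟦ N ⟧) + (1ℚ + ⟦ M ℕ.+ V ⟧ + ⟦ N ⟧) ∎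
  where
  rearrange : ∀ V A M N → suc (V ℕ.+ A ℕ.+ M ℕ.+ N) ℕ.+ suc N ≡ suc (A ℕ.+ N) ℕ.+ suc (M ℕ.+ V ℕ.+ N)
  rearrange = ℕ.solve-∀

-- After multiplying by s³αQ the recurrence leaves the correction c/(QT), and c = Q + T turns it
-- into the harmonic increments 1/T + 1/Q.
harmonic-step : ∀ H H′ S Δ s α ρ P Q R T c is iα iT iQ cV cA cV′ cA′ cA″ cAM cMV cAM′ cMV′ cAM″ →
  is * s ≡ 1ℚ → iα * α ≡ 1ℚ → iT * T ≡ 1ℚ → iQ * Q ≡ 1ℚ → c ≡ Q + T →
  H * (cV * cA) ≡ cAM * cMV * Δ →
  (H′ * (P * Q * s) - H * (R * T * s)) * α ≡ - (c * ρ * s * S) →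
  S * (cV * cA″) ≡ cAM″ * cMV →
  s * s * (cV′ * cA′) ≡ P * Q * (cV * cA) →
  s * s * (cAM′ * cMV′) ≡ R * T * (cAM * cMV) →
  α * cA″ ≡ Q * cA → ρ * cAM″ ≡ R * cAM →
  H′ * (cV′ * cA′) ≡ cAM′ * cMV′ * (Δ - iT - iQ)
harmonic-step H H′ S Δ s α ρ P Q R T _ is iα iT iQ cV cA cV′ cA′ cA″ cAM cMV cAM′ cMV′ cAM″
  is≡1 iα≡1 iT≡1 iQ≡1 refl ih recurrence saal step-D step-U up-A up-AM =
  *-cancelʳ-invertible (is * is * (is * iα * iQ))
    (product-inverse (is * is) (s * s) (is * iα * iQ) (s * α * Q) (product-inverse is s is s is≡1 is≡1)
      (product-inverse (is * iα) (s * α) iQ Q (product-inverse is s iα α is≡1 iα≡1) iQ≡1))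
    (trans lhs (sym rhs))
  where
  E = s * α * R * (cAM * cMV) * (Q * T * Δ - (Q + T))
  lhs : H′ * (cV′ * cA′) * (s * s * (s * α * Q)) ≡ E
  lhs = begin
    H′ * (cV′ * cA′) * (s * s * (s * α * Q))
      ≡⟨ solve (H′ ∷ cV′ ∷ cA′ ∷ s ∷ α ∷ Q ∷ []) ℚ-ring ⟩
    s * s * (cV′ * cA′) * (H′ * s * α * Q)
      ≡⟨ cong (_* (H′ * s * α * Q)) step-D ⟩
    P * Q * (cV * cA) * (H′ * s * α * Q)
      ≡⟨ solve (H ∷ H′ ∷ s ∷ α ∷ P ∷ Q ∷ R ∷ T ∷ cV ∷ cA ∷ []) ℚ-ring ⟩
    Q * (cV * cA) * ((H′ * (P * Q * s) - H * (R * T * s)) * α) + s * α * Q * R * T * (H * (cV * cA))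
      ≡⟨ cong₂ (λ x y → Q * (cV * cA) * x + s * α * Q * R * T * y) recurrence ih ⟩
    Q * (cV * cA) * - ((Q + T) * ρ * s * S) + s * α * Q * R * T * (cAM * cMV * Δ)
      ≡⟨ solve (S ∷ Δ ∷ s ∷ α ∷ ρ ∷ Q ∷ R ∷ T ∷ cV ∷ cA ∷ cAM ∷ cMV ∷ []) ℚ-ring ⟩
    - ((Q + T) * ρ * s * (S * cV) * (Q * cA)) + s * α * Q * R * T * (cAM * cMV * Δ)
      ≡⟨ cong (λ x → - ((Q + T) * ρ * s * (S * cV) * x) + s * α * Q * R * T * (cAM * cMV * Δ)) up-A ⟨
    - ((Q + T) * ρ * s * (S * cV) * (α * cA″)) + s * α * Q * R * T * (cAM * cMV * Δ)
      ≡⟨ solve (S ∷ s ∷ α ∷ ρ ∷ Q ∷ T ∷ cV ∷ cA″ ∷ []) ℚ-ring ⟩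
    - ((Q + T) * s * α * ρ * (S * (cV * cA″))) + s * α * Q * R * T * (cAM * cMV * Δ)
      ≡⟨ cong (λ x → - ((Q + T) * s * α * ρ * x) + s * α * Q * R * T * (cAM * cMV * Δ)) saal ⟩
    - ((Q + T) * s * α * ρ * (cAM″ * cMV)) + s * α * Q * R * T * (cAM * cMV * Δ)
      ≡⟨ solve (s ∷ α ∷ ρ ∷ Q ∷ T ∷ cAM″ ∷ cMV ∷ []) ℚ-ring ⟩
    - ((Q + T) * s * α * cMV * (ρ * cAM″)) + s * α * Q * R * T * (cAM * cMV * Δ)
      ≡⟨ cong (λ x → - ((Q + T) * s * α * cMV * x) + s * α * Q * R * T * (cAM * cMV * Δ)) up-AM ⟩
    - ((Q + T) * s * α * cMV * (R * cAM)) + s * α * Q * R * T * (cAM * cMV * Δ)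
      ≡⟨ solve (Δ ∷ s ∷ α ∷ Q ∷ R ∷ T ∷ cAM ∷ cMV ∷ []) ℚ-ring ⟩
    s * α * R * (cAM * cMV) * (Q * T * Δ - (Q + T)) ∎
  rhs : cAM′ * cMV′ * (Δ - iT - iQ) * (s * s * (s * α * Q)) ≡ E
  rhs = begin
    cAM′ * cMV′ * (Δ - iT - iQ) * (s * s * (s * α * Q))
      ≡⟨ solve (Δ ∷ s ∷ α ∷ Q ∷ iT ∷ iQ ∷ cAM′ ∷ cMV′ ∷ []) ℚ-ring ⟩
    s * s * (cAM′ * cMV′) * (s * α * Q * (Δ - iT - iQ))
      ≡⟨ cong (_* (s * α * Q * (Δ - iT - iQ))) step-U ⟩
    R * T * (cAM * cMV) * (s * α * Q * (Δ - iT - iQ))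
      ≡⟨ solve (Δ ∷ s ∷ α ∷ Q ∷ R ∷ T ∷ iT ∷ iQ ∷ cAM ∷ cMV ∷ []) ℚ-ring ⟩
    s * α * R * (cAM * cMV) * (Q * T * Δ - Q * (iT * T) - T * (iQ * Q))
      ≡⟨ cong₂ (λ x y → s * α * R * (cAM * cMV) * (Q * T * Δ - Q * x - T * y)) iT≡1 iQ≡1 ⟩
    s * α * R * (cAM * cMV) * (Q * T * Δ - Q * 1ℚ - T * 1ℚ)
      ≡⟨ solve (Δ ∷ s ∷ α ∷ Q ∷ R ∷ T ∷ cAM ∷ cMV ∷ []) ℚ-ring ⟩
    s * α * R * (cAM * cMV) * (Q * T * Δ - (Q + T)) ∎

harmonic-saalschütz : ∀ N M V A L → L ≡ V ℕ.+ A ℕ.+ M ℕ.+ N → N ≤ M →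
  harmonicSum N M V A L * (⟦ (V ℕ.+ N) C N ⟧ * ⟦ (A ℕ.+ N) C N ⟧)
  ≡ ⟦ (A ℕ.+ M ℕ.+ N) C N ⟧ * ⟦ (M ℕ.+ V ℕ.+ N) C N ⟧ * harmonicCorrection N M V A
harmonic-saalschütz zero M V A L _ _ rewrite ℕ.+-identityʳ (M ℕ.+ V) =
  regroup ⟦ 1 ⟧ (H M) (H (A ℕ.+ 0)) (H (M ℕ.+ V))
  where
  regroup : ∀ x p q s → 1ℚ * (p - q) * (x * x) ≡ x * x * (s - s + p - q)
  regroup = solve-∀ ℚ-ring
harmonic-saalschütz (suc N) M V A _ refl 1+N≤M rewrite ℕ.+-suc (V ℕ.+ A ℕ.+ M) N =
  trans (harmonic-step (harmonicSum N M V A L) (harmonicSum (suc N) M V A (suc L)) (saalSum N M V (suc A) (suc L))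
          (harmonicCorrection N M V A) s (1ℚ + ⟦ A ⟧) (1ℚ + ⟦ A ℕ.+ M ⟧) P Q R T (⟦ suc L ⟧ + ⟦ suc N ⟧)
          (1 ÷ℕ suc N) (1 ÷ℕ suc A) (1 ÷ℕ suc (M ℕ.+ V ℕ.+ N)) (1 ÷ℕ suc (A ℕ.+ N))
          cV cA cV′ cA′ cA″ cAM cMV cAM′ cMV′ cAM″
          (1÷ℕ-inverse-suc N) (1÷ℕ-inverse-suc A) (1÷ℕ-inverse-suc+ (M ℕ.+ V) N) (1÷ℕ-inverse-suc+ A N)
          ([L+1]+[N+1]≡[A+N+1]+[M+V+N+1] N M V A L refl)
          (harmonic-saalschütz N M V A L refl (ℕ.<⇒≤ 1+N≤M))
          (harmonic-recurrence N M V A L refl 1+N≤M)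
          (saalschütz N M V (suc A) (suc L) (cong (λ x → x ℕ.+ M ℕ.+ N) (sym (ℕ.+-suc V A))))
          (*-ratio s P cV cV′ s Q cA cA′ (C[x+k,k]-suc-k V N) (C[x+k,k]-suc-k A N))
          (*-ratio s R cAM cAM′ s T cMV cMV′ (C[x+k,k]-suc-k (A ℕ.+ M) N) (C[x+k,k]-suc-k (M ℕ.+ V) N))
          (C[x+k,k]-suc-x A N) (C[x+k,k]-suc-x (A ℕ.+ M) N))
        (cong (cAM′ * cMV′ *_) (sym (harmonicCorrection-suc N M V A)))
  where
  L = V ℕ.+ A ℕ.+ M ℕ.+ N
  s = 1ℚ + ⟦ N ⟧
  P = 1ℚ + ⟦ V ⟧ + ⟦ N ⟧
  Q = 1ℚ + ⟦ A ⟧ + ⟦ N ⟧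
  R = 1ℚ + ⟦ A ℕ.+ M ⟧ + ⟦ N ⟧
  T = 1ℚ + ⟦ M ℕ.+ V ⟧ + ⟦ N ⟧
  cV = ⟦ (V ℕ.+ N) C N ⟧
  cA = ⟦ (A ℕ.+ N) C N ⟧
  cAM = ⟦ (A ℕ.+ M ℕ.+ N) C N ⟧
  cMV = ⟦ (M ℕ.+ V ℕ.+ N) C N ⟧
  cV′ = ⟦ (V ℕ.+ suc N) C suc N ⟧
  cA′ = ⟦ (A ℕ.+ suc N) C suc N ⟧
  cAM′ = ⟦ (A ℕ.+ M ℕ.+ suc N) C suc N ⟧
  cMV′ = ⟦ (M ℕ.+ V ℕ.+ suc N) C suc N ⟧
  cA″ = ⟦ (suc A ℕ.+ N) C N ⟧
  cAM″ = ⟦ (suc A ℕ.+ M ℕ.+ N) C N ⟧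

harmonic-saalschütz-closed : ∀ N M V A L {a b c d} → L ≡ V ℕ.+ A ℕ.+ M ℕ.+ N → N ≤ M →
  A ℕ.+ M ℕ.+ N ≡ a → M ℕ.+ V ℕ.+ N ≡ b → A ℕ.+ N ≡ c → M ℕ.+ V ≡ d →
  harmonicSum N M V A L ≡ ((a C N) ℕ.* (b C N)) ÷ℕ (((V ℕ.+ N) C N) ℕ.* (c C N)) * (H d - H b + H M - H c)
harmonic-saalschütz-closed N M V A L balanced N≤M refl refl refl refl =
  *-cancelʳ-⟦⟧ (cV ℕ.* cA) {{denominator-nonZero V A N}} (begin
    harmonicSum N M V A L * ⟦ cV ℕ.* cA ⟧        ≡⟨ cong (harmonicSum N M V A L *_) (⟦*⟧ cV cA) ⟩
    harmonicSum N M V A L * (⟦ cV ⟧ * ⟦ cA ⟧)    ≡⟨ harmonic-saalschütz N M V A L balanced N≤M ⟩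
    ⟦ cAM ⟧ * ⟦ cMV ⟧ * Δ                         ≡⟨ cong (_* Δ) (⟦*⟧ cAM cMV) ⟨
    ⟦ cAM ℕ.* cMV ⟧ * Δ                           ≡⟨ cong (_* Δ) (÷ℕ-*-cancel (cAM ℕ.* cMV) (cV ℕ.* cA) {{denominator-nonZero V A N}}) ⟨
    (cAM ℕ.* cMV) ÷ℕ (cV ℕ.* cA) * ⟦ cV ℕ.* cA ⟧ * Δ  ≡⟨ *-right-comm ((cAM ℕ.* cMV) ÷ℕ (cV ℕ.* cA)) ⟦ cV ℕ.* cA ⟧ Δ ⟩
    (cAM ℕ.* cMV) ÷ℕ (cV ℕ.* cA) * Δ * ⟦ cV ℕ.* cA ⟧  ∎)
  where
  cV = (V ℕ.+ N) C N
  cA = (A ℕ.+ N) C N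
  cAM = (A ℕ.+ M ℕ.+ N) C N
  cMV = (M ℕ.+ V ℕ.+ N) C N
  Δ = harmonicCorrection N M V A
  *-right-comm : ∀ x y z → x * y * z ≡ x * z * y
  *-right-comm = solve-∀ ℚ-ring

-- Specialisation

-- With λ = μ + ν + 2 + κ every truncated subtraction in the statement computes.
λ′-split : ∀ {λ′ μ ν} → 1 ℕ.+ μ ℕ.+ ν ℕ.< λ′ → ∃[ κ ] μ ℕ.+ ν ℕ.+ suc (suc κ) ≡ λ′
λ′-split {μ = μ} {ν} 1+μ+ν<λ′ with ℕ.m≤n⇒∃[o]m+o≡n 1+μ+ν<λ′
... | κ , eq = κ , trans (rearrange μ ν κ) eq
  where
  rearrange : ∀ μ ν κ → μ ℕ.+ ν ℕ.+ suc (suc κ) ≡ suc (1 ℕ.+ μ ℕ.+ ν) ℕ.+ κ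
  rearrange = ℕ.solve-∀

μ+ν+x∸μ∸ν≡x : ∀ μ ν x → μ ℕ.+ ν ℕ.+ x ℕ.∸ μ ℕ.∸ ν ≡ x
μ+ν+x∸μ∸ν≡x μ ν x = trans (cong (ℕ._∸ ν) (trans (cong (ℕ._∸ μ) (ℕ.+-assoc μ ν x)) (ℕ.m+n∸m≡n μ (ν ℕ.+ x))))
                          (ℕ.m+n∸m≡n ν x)

μ+ν+x∸ν≡μ+x : ∀ μ ν x → μ ℕ.+ ν ℕ.+ x ℕ.∸ ν ≡ μ ℕ.+ x
μ+ν+x∸ν≡μ+x μ ν x = trans (cong (ℕ._∸ ν) (rearrange μ ν x)) (ℕ.m+n∸m≡n ν (μ ℕ.+ x))
  where
  rearrange : ∀ μ ν x → μ ℕ.+ ν ℕ.+ x ≡ ν ℕ.+ (μ ℕ.+ x)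
  rearrange = ℕ.solve-∀

theorem3 : (n λ′ μ ν : ℕ) → 1 ℕ.+ μ ℕ.+ ν ℕ.< λ′ →
    sumTo n (λ k →
        (((n C k) ℕ.* ((λ′ ℕ.* n ℕ.+ k) C k) ℕ.* ((μ ℕ.* n ℕ.+ n) C k))
          ÷ℕ (((ν ℕ.* n ℕ.+ k) C k) ℕ.* (((λ′ ℕ.∸ μ ℕ.∸ ν ℕ.∸ 2) ℕ.* n ℕ.+ k) C k)))
        * (H (μ ℕ.* n ℕ.+ n ℕ.∸ k) - H ((λ′ ℕ.∸ μ ℕ.∸ ν ℕ.∸ 2) ℕ.* n ℕ.+ k)))
    ≡ ((((λ′ ℕ.∸ ν) ℕ.* n) C n) ℕ.* (((μ ℕ.+ ν ℕ.+ 2) ℕ.* n) C n))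
        ÷ℕ (((ν ℕ.* n ℕ.+ n) C n) ℕ.* (((λ′ ℕ.∸ μ ℕ.∸ ν ℕ.∸ 1) ℕ.* n) C n))
      * (H ((μ ℕ.+ ν ℕ.+ 1) ℕ.* n) - H ((μ ℕ.+ ν ℕ.+ 2) ℕ.* n)
         + H (μ ℕ.* n ℕ.+ n) - H ((λ′ ℕ.∸ μ ℕ.∸ ν ℕ.∸ 1) ℕ.* n))
theorem3 n λ′ μ ν 1+μ+ν<λ′ with λ′-split {λ′} {μ} {ν} 1+μ+ν<λ′
... | κ , refl rewrite μ+ν+x∸μ∸ν≡x μ ν (suc (suc κ)) | μ+ν+x∸ν≡μ+x μ ν (suc (suc κ)) =
  harmonic-saalschütz-closed n (μ ℕ.* n ℕ.+ n) (ν ℕ.* n) (κ ℕ.* n) ((μ ℕ.+ ν ℕ.+ suc (suc κ)) ℕ.* n)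
    (balanced μ ν κ n) (ℕ.m≤n+m n (μ ℕ.* n)) (top-A+M+N μ κ n) (top-M+V+N μ ν n) (top-A+N κ n) (top-M+V μ ν n)
  where
  balanced : ∀ μ ν κ n → (μ ℕ.+ ν ℕ.+ suc (suc κ)) ℕ.* n ≡ ν ℕ.* n ℕ.+ κ ℕ.* n ℕ.+ (μ ℕ.* n ℕ.+ n) ℕ.+ n
  balanced = ℕ.solve-∀
  top-A+M+N : ∀ μ κ n → κ ℕ.* n ℕ.+ (μ ℕ.* n ℕ.+ n) ℕ.+ n ≡ (μ ℕ.+ suc (suc κ)) ℕ.* n
  top-A+M+N = ℕ.solve-∀
  top-M+V+N : ∀ μ ν n → μ ℕ.* n ℕ.+ n ℕ.+ ν ℕ.* n ℕ.+ n ≡ (μ ℕ.+ ν ℕ.+ 2) ℕ.* n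
  top-M+V+N = ℕ.solve-∀
  top-A+N : ∀ κ n → κ ℕ.* n ℕ.+ n ≡ suc κ ℕ.* n
  top-A+N = ℕ.solve-∀
  top-M+V : ∀ μ ν n → μ ℕ.* n ℕ.+ n ℕ.+ ν ℕ.* n ≡ (μ ℕ.+ ν ℕ.+ 1) ℕ.* n
  top-M+V = ℕ.solve-∀
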